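{- Let $G\cong G_1\odot G_2$ be a corona graph where $G_1$ has no isolated vertices, and let $w=(w_0,\dots,w_l)\in\mathbb{Z}^+\times\mathbb{N}^l$. If $l\ge w_0\ge w_1\ge\cdots\ge w_l$ and $|V(G_2)|\ge w_0$, then $\gamma_w(G)=w_0\gamma(G)$.
   Context: All graphs are finite and simple; $N(v)$ is the open neighbourhood and $f(S)=\sum_{u\in S}f(u)$. $\mathbb{Z}^+=\{1,2,\dots\}$, $\mathbb{N}=\mathbb{Z}^+\cup\{0\}$. For $w=(w_0,\dots,w_l)$ with nonnegative integer entries and $w_0\ge 1$, a function $f:V(G)\to\{0,\dots,l\}$ is $w$-dominating if $f(N(v))\ge w_i$ for every $v$ with $f(v)=i$; $\gamma_w(G)$ is the minimum of $\sum_v f(v)$ over $w$-dominating functions. $\gamma(G)$ is the domination number. The corona product $G_1\odot G_2$ is obtained from one copy of $G_1$ and $|V(G_1)|$ copies of $G_2$ by joining every vertex of the $i$-th copy of $G_2$ to the $i$-th vertex of $G_1$. -}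

module Defs where

open import Data.Nat using (ℕ; zero; suc; _+_; _*_; _≤_)
open import Data.Fin using (Fin; zero; suc; toℕ; splitAt; remQuot; _≟_)
open import Data.Bool using (Bool; true; false; if_then_else_; _∧_)
open import Data.Sum using (_⊎_; inj₁; inj₂)
open import Data.Product using (Σ; ∃; _×_; _,_)
open import Relation.Nullary using (¬_; does)
open import Relation.Binary.PropositionalEquality using (_≡_)

record Graph : Set where
  constructor mkGraph
  field
    n   : ℕ
    adj : Fin n → Fin n → Bool
open Graph public

record IsSimple (G : Graph) : Set where
  field
    symmetric   : ∀ u v → adj G u v ≡ adj G v u
    irreflexive : ∀ v → adj G v v ≡ false

sumFin : ∀ n → (Fin n → ℕ) → ℕ
sumFin zero    f = 0
sumFin (suc n) f = f zero + sumFin n (λ i → f (suc i))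

sumN : (G : Graph) → (Fin (n G) → ℕ) → Fin (n G) → ℕ
sumN G f v = sumFin (n G) (λ u → if adj G v u then f u else 0)

NoIsolated : Graph → Set
NoIsolated G = ∀ v → ∃ λ u → adj G v u ≡ true

-- corona product G1 ⊙ G2: vertices Fin (n1 + n1 * n2);
-- inj₁ i is the i-th vertex of G1, inj₂ (i , a) is vertex a of the i-th copy of G2.
_==_ : ∀ {m} → Fin m → Fin m → Bool
i == j = does (i ≟ j)

coronaAdj : (G1 G2 : Graph) → Fin (n G1 + n G1 * n G2) → Fin (n G1 + n G1 * n G2) → Bool
coronaAdj G1 G2 x y with splitAt (n G1) x | splitAt (n G1) y
... | inj₁ i | inj₁ j = adj G1 i j
... | inj₁ i | inj₂ q with remQuot {n G1} (n G2) q
...   | (k , _) = i == k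
coronaAdj G1 G2 x y | inj₂ p | inj₁ j with remQuot {n G1} (n G2) p
...   | (k , _) = k == j
coronaAdj G1 G2 x y | inj₂ p | inj₂ q with remQuot {n G1} (n G2) p | remQuot {n G1} (n G2) q
...   | (k , a) | (k' , b) = (k == k') ∧ adj G2 a b

_⊙_ : Graph → Graph → Graph
G1 ⊙ G2 = mkGraph (n G1 + n G1 * n G2) (coronaAdj G1 G2)

weight : (G : Graph) → (Fin (n G) → ℕ) → ℕ
weight G f = sumFin (n G) f

IsMinWeight : (G : Graph) → ((Fin (n G) → ℕ) → Set) → ℕ → Set
IsMinWeight G P k =
  (Σ (Fin (n G) → ℕ) λ f → P f × weight G f ≡ k) × (∀ f → P f → k ≤ weight G f)

IsIndicator : ∀ {m} → (Fin m → ℕ) → Set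
IsIndicator f = ∀ v → f v ≡ 0 ⊎ f v ≡ 1

Dominating : (G : Graph) → (Fin (n G) → ℕ) → Set
Dominating G s = IsIndicator s × (∀ v → s v ≡ 0 → 1 ≤ sumN G s v)

IsDominationNumber : Graph → ℕ → Set
IsDominationNumber G k = IsMinWeight G (Dominating G) k

-- w = (w_0, …, w_l) as a function Fin (suc l) → ℕ.
-- f : V → {0,…,l} is w-dominating iff f(N(v)) ≥ w_{f(v)} for all v.
WDominating : (l : ℕ) → (Fin (suc l) → ℕ) → (G : Graph) → (Fin (n G) → ℕ) → Set
WDominating l w G f =
  Σ (∀ v → f v ≤ l) λ bound →
    ∀ v → (i : Fin (suc l)) → toℕ i ≡ f v → w i ≤ sumN G f v

IsWDominationNumber : (l : ℕ) → (Fin (suc l) → ℕ) → Graph → ℕ → Set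
IsWDominationNumber l w G k = IsMinWeight G (WDominating l w G) k

-- In G1 ⊙ G2 each copy of G2 together with its base vertex carries weight at least w₀:
-- if some vertex of the copy has value 0, its neighbourhood (the copy and the base vertex)
-- carries w₀; otherwise the |V(G2)| ≥ w₀ vertices of the copy each carry at least 1.
-- Hence γ_w ≥ w₀ |V(G1)|, attained by the value w₀ on V(G1) and 0 elsewhere (a vertex of G1
-- has a neighbour in G1, and every wᵢ ≤ w₀). For w = (1, 0) this gives γ = |V(G1)|.
module Submission where

open import Defs
open import Data.Nat using (ℕ; zero; suc; _+_; _*_; _≤_; z≤n; s≤s)
open import Data.Nat.Properties hiding (_≟_; suc-injective)
open import Algebra.Properties.CommutativeSemigroup +-commutativeSemigroup using (interchange)
open import Data.Fin using (Fin; zero; suc; toℕ; _↑ˡ_; _↑ʳ_; splitAt; combine; remQuot; join; _≟_)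
open import Data.Fin.Properties
  using (suc-injective; splitAt-↑ˡ; splitAt-↑ʳ; remQuot-combine; join-splitAt; combine-remQuot)
open import Data.Bool using (true; false; if_then_else_; _∧_)
open import Data.Sum using (_⊎_; inj₁; inj₂; [_,_]′)
open import Data.Product using (∃; _,_; proj₁; proj₂)
open import Function using (const; _∘_)
open import Relation.Nullary using (¬_)
open import Relation.Nullary.Decidable using (dec-true; dec-false)
open import Relation.Binary.PropositionalEquality

sumFin-cong : ∀ n {h h′ : Fin n → ℕ} → (∀ i → h i ≡ h′ i) → sumFin n h ≡ sumFin n h′
sumFin-cong zero    e = refl
sumFin-cong (suc n) e = cong₂ _+_ (e zero) (sumFin-cong n (λ i → e (suc i)))

sumFin-mono-≤ : ∀ n {h h′ : Fin n → ℕ} → (∀ i → h i ≤ h′ i) → sumFin n h ≤ sumFin n h′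
sumFin-mono-≤ zero    e = z≤n
sumFin-mono-≤ (suc n) e = +-mono-≤ (e zero) (sumFin-mono-≤ n (λ i → e (suc i)))

sumFin-const : ∀ n c → sumFin n (const c) ≡ n * c
sumFin-const zero    c = refl
sumFin-const (suc n) c = cong (c +_) (sumFin-const n c)

sumFin-zero : ∀ n {h : Fin n → ℕ} → (∀ i → h i ≡ 0) → sumFin n h ≡ 0
sumFin-zero n e = trans (sumFin-cong n e) (trans (sumFin-const n 0) (*-zeroʳ n))

sumFin-distrib-+ : ∀ n (h h′ : Fin n → ℕ) →
  sumFin n (λ i → h i + h′ i) ≡ sumFin n h + sumFin n h′
sumFin-distrib-+ zero    h h′ = refl
sumFin-distrib-+ (suc n) h h′ =
  trans (cong (h zero + h′ zero +_) (sumFin-distrib-+ n (λ i → h (suc i)) (λ i → h′ (suc i))))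
        (interchange (h zero) (h′ zero) _ _)

sumFin-++ : ∀ m k (h : Fin (m + k) → ℕ) →
  sumFin (m + k) h ≡ sumFin m (λ i → h (i ↑ˡ k)) + sumFin k (λ j → h (m ↑ʳ j))
sumFin-++ zero    k h = refl
sumFin-++ (suc m) k h =
  trans (cong (h zero +_) (sumFin-++ m k (λ i → h (suc i)))) (sym (+-assoc (h zero) _ _))

sumFin-combine : ∀ m k (h : Fin (m * k) → ℕ) →
  sumFin (m * k) h ≡ sumFin m (λ i → sumFin k (λ j → h (combine i j)))
sumFin-combine zero    k h = refl
sumFin-combine (suc m) k h =
  trans (sumFin-++ k (m * k) h)
        (cong (sumFin k (λ j → h (j ↑ˡ (m * k))) +_) (sumFin-combine m k (λ q → h (k ↑ʳ q))))

sumFin-single : ∀ n (h : Fin n → ℕ) k → (∀ j → ¬ j ≡ k → h j ≡ 0) → sumFin n h ≡ h k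
sumFin-single (suc n) h zero    e =
  trans (cong (h zero +_) (sumFin-zero n (λ i → e (suc i) λ ()))) (+-identityʳ _)
sumFin-single (suc n) h (suc k) e =
  cong₂ _+_ (e zero λ ())
    (sumFin-single n (λ i → h (suc i)) k λ j j≢k → e (suc j) (j≢k ∘ suc-injective))

term≤sumFin : ∀ n (h : Fin n → ℕ) u → h u ≤ sumFin n h
term≤sumFin (suc n) h zero    = m≤m+n _ _
term≤sumFin (suc n) h (suc u) = ≤-trans (term≤sumFin n (λ i → h (suc i)) u) (m≤n+m _ _)

hasZero⊎n≤sumFin : ∀ n (h : Fin n → ℕ) → (∃ λ a → h a ≡ 0) ⊎ n ≤ sumFin n h
hasZero⊎n≤sumFin zero    h = inj₂ z≤n
hasZero⊎n≤sumFin (suc n) h with h zero in eq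
... | zero  = inj₁ (zero , eq)
... | suc _ with hasZero⊎n≤sumFin n (λ i → h (suc i))
...   | inj₁ (a , e) = inj₁ (suc a , e)
...   | inj₂ n≤Σ     = inj₂ (+-mono-≤ (s≤s z≤n) n≤Σ)

if-≤ : ∀ b x → (if b then x else 0) ≤ x
if-≤ true  x = ≤-refl
if-≤ false x = z≤n

adj⇒≤sumN : ∀ G (f : Fin (n G) → ℕ) {v u} → adj G v u ≡ true → f u ≤ sumN G f v
adj⇒≤sumN G f {v} {u} v~u = ≤-trans (≤-reflexive (cong (λ b → if b then f u else 0) (sym v~u)))
  (term≤sumFin (n G) (λ u → if adj G v u then f u else 0) u)

IsMinWeight-unique : ∀ {G P k k′} → IsMinWeight G P k → IsMinWeight G P k′ → k ≡ k′
IsMinWeight-unique ((f , Pf , f≡k) , k-min) ((f′ , Pf′ , f′≡k′) , k′-min) =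
  ≤-antisym (subst (_ ≤_) f′≡k′ (k-min f′ Pf′)) (subst (_ ≤_) f≡k (k′-min f Pf))

module Corona (G1 G2 : Graph) where
  private
    n1 = n G1
    n2 = n G2

  base : Fin n1 → Fin (n1 + n1 * n2)
  base i = i ↑ˡ (n1 * n2)

  copy : Fin n1 → Fin n2 → Fin (n1 + n1 * n2)
  copy k a = n1 ↑ʳ combine k a

  data Vertex : Fin (n1 + n1 * n2) → Set where
    is-base : ∀ i → Vertex (base i)
    is-copy : ∀ k a → Vertex (copy k a)

  vertex : ∀ x → Vertex x
  vertex x with splitAt n1 x in eq
  ... | inj₁ i = subst Vertex x≡ (is-base i)
    where
    x≡ : base i ≡ x
    x≡ = trans (cong (join n1 (n1 * n2)) (sym eq)) (join-splitAt n1 (n1 * n2) x)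
  ... | inj₂ q = subst Vertex x≡ (is-copy (proj₁ (remQuot {n1} n2 q)) (proj₂ (remQuot {n1} n2 q)))
    where
    x≡ : n1 ↑ʳ combine (proj₁ (remQuot {n1} n2 q)) (proj₂ (remQuot {n1} n2 q)) ≡ x
    x≡ = trans (cong (n1 ↑ʳ_) (combine-remQuot {n1} n2 q))
      (trans (cong (join n1 (n1 * n2)) (sym eq)) (join-splitAt n1 (n1 * n2) x))

  adj-base-base : ∀ i j → adj (G1 ⊙ G2) (base i) (base j) ≡ adj G1 i j
  adj-base-base i j rewrite splitAt-↑ˡ n1 i (n1 * n2) | splitAt-↑ˡ n1 j (n1 * n2) = refl

  adj-copy-base : ∀ k a j → adj (G1 ⊙ G2) (copy k a) (base j) ≡ (k == j)
  adj-copy-base k a j rewrite splitAt-↑ʳ n1 (n1 * n2) (combine k a) | splitAt-↑ˡ n1 j (n1 * n2) =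
    cong (λ p → proj₁ p == j) (remQuot-combine {n1} {n2} k a)

  adj-copy-copy : ∀ k a k′ a′ → adj (G1 ⊙ G2) (copy k a) (copy k′ a′) ≡ ((k == k′) ∧ adj G2 a a′)
  adj-copy-copy k a k′ a′
    rewrite splitAt-↑ʳ n1 (n1 * n2) (combine k a) | splitAt-↑ʳ n1 (n1 * n2) (combine k′ a′) =
    cong₂ (λ p q → (proj₁ p == proj₁ q) ∧ adj G2 (proj₂ p) (proj₂ q))
      (remQuot-combine {n1} {n2} k a) (remQuot-combine {n1} {n2} k′ a′)

  weight-byCopies : ∀ f →
    weight (G1 ⊙ G2) f ≡ sumFin n1 (λ k → f (base k) + sumFin n2 (λ a → f (copy k a)))
  weight-byCopies f = begin
    weight (G1 ⊙ G2) f
      ≡⟨ sumFin-++ n1 (n1 * n2) f ⟩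
    sumFin n1 (f ∘ base) + sumFin (n1 * n2) (λ q → f (n1 ↑ʳ q))
      ≡⟨ cong (sumFin n1 (f ∘ base) +_) (sumFin-combine n1 n2 _) ⟩
    sumFin n1 (f ∘ base) + sumFin n1 (λ k → sumFin n2 (λ a → f (copy k a)))
      ≡⟨ sumFin-distrib-+ n1 _ _ ⟨
    sumFin n1 (λ k → f (base k) + sumFin n2 (λ a → f (copy k a)))
      ∎
    where open ≡-Reasoning

  sumN-copy≤ : ∀ f k a →
    sumN (G1 ⊙ G2) f (copy k a) ≤ f (base k) + sumFin n2 (λ a′ → f (copy k a′))
  sumN-copy≤ f k a = ≤-trans (≤-reflexive (sumFin-++ n1 (n1 * n2) _))
    (+-mono-≤ fromBase (≤-trans (≤-reflexive (sumFin-combine n1 n2 _)) fromCopies))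
    where
    fromBase : sumFin n1 (λ j → if adj (G1 ⊙ G2) (copy k a) (base j) then f (base j) else 0)
      ≤ f (base k)
    fromBase = ≤-trans (≤-reflexive (sumFin-single n1 _ k λ j j≢k →
        cong (λ b → if b then f (base j) else 0)
          (trans (adj-copy-base k a j) (dec-false (k ≟ j) (j≢k ∘ sym)))))
      (if-≤ _ _)
    fromCopies : sumFin n1 (λ k′ → sumFin n2 (λ a′ →
        if adj (G1 ⊙ G2) (copy k a) (copy k′ a′) then f (copy k′ a′) else 0))
      ≤ sumFin n2 (λ a′ → f (copy k a′))
    fromCopies = ≤-trans (≤-reflexive (sumFin-single n1 _ k λ k′ k′≢k → sumFin-zero n2 λ a′ →
        cong (λ b → if b then f (copy k′ a′) else 0)
          (trans (adj-copy-copy k a k′ a′) (cong (_∧ adj G2 a a′) (dec-false (k ≟ k′) (k′≢k ∘ sym))))))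
      (sumFin-mono-≤ n2 (λ a′ → if-≤ _ _))

  weight-lowerBound : ∀ f c → c ≤ n2 →
    (∀ k a → f (copy k a) ≡ 0 → c ≤ sumN (G1 ⊙ G2) f (copy k a)) →
    c * n1 ≤ weight (G1 ⊙ G2) f
  weight-lowerBound f c c≤n2 zero⇒c≤sumN = begin
    c * n1                    ≡⟨ *-comm c n1 ⟩
    n1 * c                    ≡⟨ sumFin-const n1 c ⟨
    sumFin n1 (const c)       ≤⟨ sumFin-mono-≤ n1 c≤perCopy ⟩
    sumFin n1 (λ k → f (base k) + sumFin n2 (λ a → f (copy k a)))
                              ≡⟨ weight-byCopies f ⟨
    weight (G1 ⊙ G2) f        ∎
    where
    open ≤-Reasoning
    c≤perCopy : ∀ k → c ≤ f (base k) + sumFin n2 (λ a → f (copy k a))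
    c≤perCopy k with hasZero⊎n≤sumFin n2 (λ a → f (copy k a))
    ... | inj₁ (a , fa≡0) = ≤-trans (zero⇒c≤sumN k a fa≡0) (sumN-copy≤ f k a)
    ... | inj₂ n2≤Σ       = ≤-trans c≤n2 (≤-trans n2≤Σ (m≤n+m _ _))

  onBase : ℕ → Fin (n1 + n1 * n2) → ℕ
  onBase c x = [ const c , const 0 ]′ (splitAt n1 x)

  onBase-base : ∀ c i → onBase c (base i) ≡ c
  onBase-base c i rewrite splitAt-↑ˡ n1 i (n1 * n2) = refl

  onBase-↑ʳ : ∀ c q → onBase c (n1 ↑ʳ q) ≡ 0
  onBase-↑ʳ c q rewrite splitAt-↑ʳ n1 (n1 * n2) q = refl

  onBase-values : ∀ c x → onBase c x ≡ 0 ⊎ onBase c x ≡ c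
  onBase-values c x with splitAt n1 x
  ... | inj₁ _ = inj₂ refl
  ... | inj₂ _ = inj₁ refl

  weight-onBase : ∀ c → weight (G1 ⊙ G2) (onBase c) ≡ c * n1
  weight-onBase c = begin
    weight (G1 ⊙ G2) (onBase c)
      ≡⟨ sumFin-++ n1 (n1 * n2) (onBase c) ⟩
    sumFin n1 (onBase c ∘ base) + sumFin (n1 * n2) (onBase c ∘ (n1 ↑ʳ_))
      ≡⟨ cong₂ _+_ (trans (sumFin-cong n1 (onBase-base c)) (sumFin-const n1 c))
                   (sumFin-zero (n1 * n2) (onBase-↑ʳ c)) ⟩
    n1 * c + 0
      ≡⟨ trans (+-identityʳ _) (*-comm n1 c) ⟩
    c * n1
      ∎
    where open ≡-Reasoning

  c≤sumN-onBase-copy : ∀ c k a → c ≤ sumN (G1 ⊙ G2) (onBase c) (copy k a)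
  c≤sumN-onBase-copy c k a = ≤-trans (≤-reflexive (sym (onBase-base c k)))
    (adj⇒≤sumN (G1 ⊙ G2) (onBase c) (trans (adj-copy-base k a k) (dec-true (k ≟ k) refl)))

open Corona

corona-domination : ∀ G1 G2 → 1 ≤ n G2 → IsDominationNumber (G1 ⊙ G2) (n G1)
corona-domination G1 G2 1≤n2 =
  (onBase G1 G2 1 , dominating , trans (weight-onBase G1 G2 1) (*-identityˡ _)) ,
  λ s (_ , dom) → subst (_≤ weight (G1 ⊙ G2) s) (*-identityˡ (n G1))
    (weight-lowerBound G1 G2 s 1 1≤n2 (λ k a → dom (copy G1 G2 k a)))
  where
  dominating : Dominating (G1 ⊙ G2) (onBase G1 G2 1)
  dominating = onBase-values G1 G2 1 , λ x → dominated x (vertex G1 G2 x)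
    where
    dominated : ∀ x → Vertex G1 G2 x →
      onBase G1 G2 1 x ≡ 0 → 1 ≤ sumN (G1 ⊙ G2) (onBase G1 G2 1) x
    dominated _ (is-base i) 1≡0 with () ← trans (sym (onBase-base G1 G2 1 i)) 1≡0
    dominated _ (is-copy k a) _ = c≤sumN-onBase-copy G1 G2 1 k a

corona-wDomination : ∀ G1 G2 → NoIsolated G1 → (l : ℕ) (w : Fin (suc l) → ℕ) →
  (∀ i → w i ≤ w zero) → w zero ≤ l → w zero ≤ n G2 →
  IsWDominationNumber l w (G1 ⊙ G2) (w zero * n G1)
corona-wDomination G1 G2 noIsolated l w wᵢ≤w₀ w₀≤l w₀≤n2 =
  (onBase G1 G2 (w zero) , (bounded , dominated) , weight-onBase G1 G2 (w zero)) ,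
  λ f (_ , wDom) → weight-lowerBound G1 G2 f (w zero) w₀≤n2
    (λ k a fka≡0 → wDom (copy G1 G2 k a) zero (sym fka≡0))
  where
  f₀ = onBase G1 G2 (w zero)
  bounded : ∀ x → f₀ x ≤ l
  bounded x with onBase-values G1 G2 (w zero) x
  ... | inj₁ fx≡0  = subst (_≤ l) (sym fx≡0) z≤n
  ... | inj₂ fx≡w₀ = subst (_≤ l) (sym fx≡w₀) w₀≤l
  dominatedAt : ∀ x → Vertex G1 G2 x → ∀ i → toℕ i ≡ f₀ x → w i ≤ sumN (G1 ⊙ G2) f₀ x
  dominatedAt _ (is-base j) i _ with noIsolated j
  ... | u , j~u = ≤-trans (wᵢ≤w₀ i) (≤-trans (≤-reflexive (sym (onBase-base G1 G2 (w zero) u)))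
    (adj⇒≤sumN (G1 ⊙ G2) f₀ (trans (adj-base-base G1 G2 j u) j~u)))
  dominatedAt _ (is-copy k a) zero    _ = c≤sumN-onBase-copy G1 G2 (w zero) k a
  dominatedAt _ (is-copy k a) (suc i) i≡0
    with () ← trans i≡0 (onBase-↑ʳ G1 G2 (w zero) (combine k a))
  dominated : ∀ x i → toℕ i ≡ f₀ x → w i ≤ sumN (G1 ⊙ G2) f₀ x
  dominated x = dominatedAt x (vertex G1 G2 x)

theorem3p4 : (G1 G2 : Graph) → IsSimple G1 → IsSimple G2 → NoIsolated G1 →
    (l : ℕ) → (w : Fin (suc l) → ℕ) →
    1 ≤ w zero → w zero ≤ l →
    (∀ (i j : Fin (suc l)) → toℕ i ≤ toℕ j → w j ≤ w i) →
    w zero ≤ n G2 →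
    (g : ℕ) → IsDominationNumber (G1 ⊙ G2) g →
    IsWDominationNumber l w (G1 ⊙ G2) (w zero * g)
theorem3p4 G1 G2 _ _ noIsolated l w 1≤w₀ w₀≤l antitone w₀≤n2 g γ≡g =
  subst (λ m → IsWDominationNumber l w (G1 ⊙ G2) (w zero * m)) n1≡g
    (corona-wDomination G1 G2 noIsolated l w (λ i → antitone zero i z≤n) w₀≤l w₀≤n2)
  where
  n1≡g : n G1 ≡ g
  n1≡g = IsMinWeight-unique {G1 ⊙ G2} {Dominating (G1 ⊙ G2)}
    (corona-domination G1 G2 (≤-trans 1≤w₀ w₀≤n2)) γ≡g
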